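{- For every integer $q\geq 5$ and every rational number $r$ with $\tfrac12<r<1$, there exists $u\in\mathbb{N}$ such that $\frac{s_q(u^2)}{s_q(u)}=r$.
   Context: $s_q(n)$ denotes the sum of the digits of $n$ in base $q$. -}

module Defs where

open import Data.Nat using (ℕ; zero; suc; _+_; _/_; _%_)

-- Sum of the base-(suc (suc k)) digits of n, i.e. s_q(n) with q = k + 2.
-- The first argument is fuel; with fuel ≥ n the recursion fully expands
-- n (since n / q < n for n ≥ 1), so it computes the genuine digit sum.
digitSumAux : (k fuel n : ℕ) → ℕ
digitSumAux k zero n = 0
digitSumAux k (suc f) zero = 0
digitSumAux k (suc f) n@(suc _) = n % suc (suc k) + digitSumAux k f (n / suc (suc k))

s : (k n : ℕ) → ℕ
s k n = digitSumAux k n n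

module Submission where

-- Write q = k + 2 and let full e = q^e - 1 be
-- the e-digit number all of whose digits are q - 1, so s_q(full e) = e(q-1).
-- For m = c + 2 and n = m + t + 1 take
--     u = full n + q^(n+1) full (c+1),
-- whose digits are n copies of q-1, one 0 and c+1 copies of q-1.  A polynomial
-- identity gives u² = 1 + q^n (B₁ + q^n B₂), where B₁ and B₂ are written with
-- explicit digits (q-2, 1, 0, 2 and q-1); as these blocks do not overlap, no
-- carries occur and
--     s_q(u²) = (c + t + 4)(q-1),   s_q(u) = (2c + t + 4)(q-1).
-- So every ratio N/(N + c) with c + 4 ≤ N is attained, and a/b with
-- 1/2 < a/b < 1 equals 4a/(4a + 4(b-a)), where 4(b-a) + 4 ≤ 4a.

open import Defs
open import Data.Nat using (ℕ; _+_; _*_; _≤_; NonZero)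
open import Data.Integer using (+_)
open import Data.Rational using (ℚ; ½; 1ℚ; _<_; _/_)
open import Data.Product using (∃; Σ)
open import Relation.Binary.PropositionalEquality using (_≡_)

open import Data.Nat as N using (zero; suc; _^_; _%_; z≤n; s≤s)
open import Data.Nat.Properties
open import Data.Nat.DivMod
  using (m/n<m; m≡m%n+[m/n]*n; m<n⇒m%n≡m; m<n⇒m/n≡0; %-remove-+ʳ; +-distrib-/-∣ʳ; m*n/n≡m; m<n*o⇒m/o<n; m%n<n)
open import Data.Nat.Divisibility using (m∣m*n)
open import Data.Nat.Coprimality using (Coprime)
open import Data.Nat.Tactic.RingSolver using (solve-∀)
open import Data.Integer as Z using (-[1+_])
open import Data.Integer.Properties using (pos-*; drop‿+<+)
open import Data.Rational using (mkℚ; *<*)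
open import Data.Rational.Properties using (fromℚᵘ-cong; /-cong; ↥p/↧p≡p)
open import Data.Rational.Unnormalised using (mkℚᵘ; *≡*)
open import Data.Product using (_,_; _×_)
open import Relation.Binary.PropositionalEquality
  using (refl; sym; trans; cong; cong₂; subst; subst₂; module ≡-Reasoning)

RatioAttained : ℕ → ℚ → Set
RatioAttained k r = ∃ λ u → Σ (NonZero (s k u)) λ nz → ((+ s k (u * u)) / s k u) {{nz}} ≡ r

-- The polynomial identity behind u², with q = 2 + k, a = full c, b = full t,
-- X = q^m = q²(a+1), P = q^n = X q (b+1) and full n written in digits.
square-identity : ∀ k a b →
  let q = 2 + k
      X = q * (q * suc a)
      P = X * (q * suc b)
      u = (suc k + q * (suc k + q * a)) + X * (suc k + q * b) + P * (q * (suc k + q * a))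
  in u * u ≡ 1 + P * ((k + q * 1 + X * (k + q * b)) + P * (q * k + X * (2 + q * (k + q * a))))
square-identity = solve-∀

module _ (k : ℕ) where
  private
    q : ℕ
    q = suc (suc k)

    1<q : 1 N.< q
    1<q = s≤s (s≤s z≤n)

  fuel-irrelevant : ∀ f g n → n ≤ f → n ≤ g → digitSumAux k f n ≡ digitSumAux k g n
  fuel-irrelevant zero    zero    zero    _ _ = refl
  fuel-irrelevant zero    (suc g) zero    _ _ = refl
  fuel-irrelevant (suc f) zero    zero    _ _ = refl
  fuel-irrelevant (suc f) (suc g) zero    _ _ = refl
  fuel-irrelevant (suc f) (suc g) (suc n) (s≤s n≤f) (s≤s n≤g) =
    cong (_+_ (suc n % q)) (fuel-irrelevant f g (suc n N./ q) (quotient≤ n≤f) (quotient≤ n≤g))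
    where
    quotient≤ : ∀ {f} → n ≤ f → suc n N./ q ≤ f
    quotient≤ = ≤-trans (N.s≤s⁻¹ (m/n<m (suc n) q 1<q))

  s-step : ∀ n → s k n ≡ n % q + s k (n N./ q)
  s-step zero    = refl
  s-step (suc n) = cong (_+_ (suc n % q)) (fuel-irrelevant n (suc n N./ q) (suc n N./ q) below ≤-refl)
    where
    below : suc n N./ q ≤ n
    below = N.s≤s⁻¹ (m/n<m (suc n) q 1<q)

  s-digit : ∀ {d} y → d N.< q → s k (d + q * y) ≡ d + s k y
  s-digit {d} y d<q = begin
      s k (d + q * y)                           ≡⟨ s-step (d + q * y) ⟩
      (d + q * y) % q + s k ((d + q * y) N./ q) ≡⟨ cong₂ (λ r z → r + s k z) last-digit rest ⟩
      d + s k y                                 ∎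
    where
    open ≡-Reasoning
    last-digit : (d + q * y) % q ≡ d
    last-digit = trans (%-remove-+ʳ d (m∣m*n y)) (m<n⇒m%n≡m d<q)
    rest : (d + q * y) N./ q ≡ y
    rest = begin
      (d + q * y) N./ q       ≡⟨ +-distrib-/-∣ʳ d (m∣m*n y) ⟩
      d N./ q + q * y N./ q   ≡⟨ cong₂ _+_ (m<n⇒m/n≡0 d<q) (cong (N._/ q) (*-comm q y)) ⟩
      y * q N./ q             ≡⟨ m*n/n≡m y q ⟩
      y                       ∎

  s-single : ∀ {d} → d N.< q → s k d ≡ d
  s-single {d} d<q = begin
      s k d                   ≡⟨ s-step d ⟩
      d % q + s k (d N./ q)   ≡⟨ cong₂ (λ r z → r + s k z) (m<n⇒m%n≡m d<q) (m<n⇒m/n≡0 d<q) ⟩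
      d + 0                   ≡⟨ +-identityʳ d ⟩
      d                       ∎
    where open ≡-Reasoning

  split-digit : ∀ x → x ≡ x % q + q * (x N./ q)
  split-digit x = trans (m≡m%n+[m/n]*n x q) (cong (_+_ (x % q)) (*-comm (x N./ q) q))

  s-concat : ∀ e x y → x N.< q ^ e → s k (x + q ^ e * y) ≡ s k x + s k y
  s-concat zero    zero    y _        = cong (s k) (*-identityˡ y)
  s-concat zero    (suc x) y (s≤s ())
  s-concat (suc e) x       y x<q^1+e  = begin
      s k (x + q ^ suc e * y)                  ≡⟨ cong (s k) regroup ⟩
      s k (x % q + q * (x N./ q + q ^ e * y))  ≡⟨ s-digit (x N./ q + q ^ e * y) (m%n<n x q) ⟩
      x % q + s k (x N./ q + q ^ e * y)        ≡⟨ cong (_+_ (x % q)) (s-concat e (x N./ q) y x/q<q^e) ⟩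
      x % q + (s k (x N./ q) + s k y)          ≡⟨ sym (+-assoc (x % q) _ _) ⟩
      (x % q + s k (x N./ q)) + s k y          ≡⟨ cong (_+ s k y) (sym (s-digit (x N./ q) (m%n<n x q))) ⟩
      s k (x % q + q * (x N./ q)) + s k y      ≡⟨ cong (λ z → s k z + s k y) (sym (split-digit x)) ⟩
      s k x + s k y                            ∎
    where
    open ≡-Reasoning
    x/q<q^e : x N./ q N.< q ^ e
    x/q<q^e = m<n*o⇒m/o<n (subst (x N.<_) (*-comm q (q ^ e)) x<q^1+e)
    regroup : x + q ^ suc e * y ≡ x % q + q * (x N./ q + q ^ e * y)
    regroup = begin
      x + q * q ^ e * y                     ≡⟨ cong (_+ q * q ^ e * y) (split-digit x) ⟩
      x % q + q * (x N./ q) + q * q ^ e * y ≡⟨ lemma (x % q) q (x N./ q) (q ^ e) y ⟩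
      x % q + q * (x N./ q + q ^ e * y)     ∎
      where
      lemma : ∀ r q a p y → r + q * a + q * p * y ≡ r + q * (a + p * y)
      lemma = solve-∀

  digit-bound : ∀ {d y} f → d N.< q → y N.< q ^ f → d + q * y N.< q ^ suc f
  digit-bound {d} {y} f d<q y<q^f = begin-strict
      d + q * y   <⟨ +-monoˡ-< (q * y) d<q ⟩
      q + q * y   ≡⟨ sym (*-suc q y) ⟩
      q * suc y   ≤⟨ *-monoʳ-≤ q y<q^f ⟩
      q * q ^ f   ∎
    where open ≤-Reasoning

  concat-bound : ∀ e f {x y} → x N.< q ^ e → y N.< q ^ f → x + q ^ e * y N.< q ^ (e + f)
  concat-bound e f {x} {y} x<q^e y<q^f = begin-strict
      x + q ^ e * y     <⟨ +-monoˡ-< (q ^ e * y) x<q^e ⟩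
      q ^ e + q ^ e * y ≡⟨ sym (*-suc (q ^ e) y) ⟩
      q ^ e * suc y     ≤⟨ *-monoʳ-≤ (q ^ e) y<q^f ⟩
      q ^ e * q ^ f     ≡⟨ sym (^-distribˡ-+-* q e f) ⟩
      q ^ (e + f)       ∎
    where open ≤-Reasoning

  full : ℕ → ℕ
  full zero    = 0
  full (suc e) = suc k + q * full e

  full+1 : ∀ e → suc (full e) ≡ q ^ e
  full+1 zero    = refl
  full+1 (suc e) = begin
      suc (suc k + q * full e) ≡⟨ lemma k (full e) ⟩
      q * suc (full e)         ≡⟨ cong (q *_) (full+1 e) ⟩
      q ^ suc e                ∎
    where
    open ≡-Reasoning
    lemma : ∀ k r → suc (suc k + (2 + k) * r) ≡ (2 + k) * suc r
    lemma = solve-∀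

  full< : ∀ e → full e N.< q ^ e
  full< e = subst (full e N.<_) (full+1 e) ≤-refl

  s-full : ∀ e → s k (full e) ≡ e * suc k
  s-full zero    = refl
  s-full (suc e) = trans (s-digit (full e) ≤-refl) (cong (_+_ (suc k)) (s-full e))

  full-+ : ∀ e f → full (e + f) ≡ full e + q ^ e * full f
  full-+ zero    f = sym (+-identityʳ (full f))
  full-+ (suc e) f = begin
      suc k + q * full (e + f)                ≡⟨ cong (λ z → suc k + q * z) (full-+ e f) ⟩
      suc k + q * (full e + q ^ e * full f)   ≡⟨ lemma (suc k) q (full e) (q ^ e) (full f) ⟩
      suc k + q * full e + q * q ^ e * full f ∎
    where
    open ≡-Reasoning
    lemma : ∀ a q b p d → a + q * (b + p * d) ≡ a + q * b + q * p * d
    lemma = solve-∀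

  module Witness (c t : ℕ) where
    m n u B₁ B₂ : ℕ
    m  = 2 + c
    n  = m + suc t
    u  = full n + q ^ n * (q * full (suc c))
    -- digits, lowest first, with a block boundary at position m:
    --   B₁ = (q-2, 1, 0, …, 0 | q-2, q-1, …, q-1)
    B₁ = (k + q * 1) + q ^ m * (k + q * full t)
    --   B₂ = (0, q-2, 0, …, 0 | 2, q-2, q-1, …, q-1)
    B₂ = q * k + q ^ m * (2 + q * (k + q * full c))

    square-expansion : u * u ≡ 1 + q ^ n * (B₁ + q ^ n * B₂)
    square-expansion = instantiate (q ^ m) (q ^ n) (full n) q^m≡ q^n≡ full-n≡
      where
      a b : ℕ
      a = full c
      b = full t
      instantiate : ∀ X P F → X ≡ q * (q * suc a) → P ≡ X * (q * suc b) →
        F ≡ (suc k + q * (suc k + q * a)) + X * (suc k + q * b) →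
        (F + P * (q * (suc k + q * a))) * (F + P * (q * (suc k + q * a)))
          ≡ 1 + P * ((k + q * 1 + X * (k + q * b)) + P * (q * k + X * (2 + q * (k + q * a))))
      instantiate _ _ _ refl refl refl = square-identity k a b
      q^m≡ : q ^ m ≡ q * (q * suc a)
      q^m≡ = cong (λ z → q * (q * z)) (sym (full+1 c))
      q^n≡ : q ^ n ≡ q ^ m * (q * suc b)
      q^n≡ = trans (^-distribˡ-+-* q m (suc t)) (cong (λ z → q ^ m * (q * z)) (sym (full+1 t)))
      full-n≡ : full n ≡ full m + q ^ m * full (suc t)
      full-n≡ = full-+ m (suc t)

    s-u : s k u ≡ (c + 4 + t + c) * suc k
    s-u = begin
        s k u                                       ≡⟨ s-concat n (full n) _ (full< n) ⟩
        s k (full n) + s k (q * full (suc c))       ≡⟨ cong₂ _+_ (s-full n) (s-digit (full (suc c)) (s≤s z≤n)) ⟩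
        n * suc k + s k (full (suc c))              ≡⟨ cong (_+_ (n * suc k)) (s-full (suc c)) ⟩
        (2 + c + suc t) * suc k + suc c * suc k     ≡⟨ lemma c t (suc k) ⟩
        (c + 4 + t + c) * suc k                     ∎
      where
      open ≡-Reasoning
      lemma : ∀ c t p → (2 + c + (1 + t)) * p + (1 + c) * p ≡ (c + 4 + t + c) * p
      lemma = solve-∀

    k<q : k N.< q
    k<q = s≤s (n≤1+n k)

    two-digits-bound : ∀ {d e} → d N.< q → e N.< q → d + q * e N.< q ^ m
    two-digits-bound {e = e} d<q e<q =
      <-≤-trans (digit-bound 1 d<q (subst (e N.<_) (sym (*-identityʳ q)) e<q))
                (^-monoʳ-≤ q (m≤m+n 2 c))

    1<q^n : 1 N.< q ^ n
    1<q^n = <-≤-trans (subst (1 N.<_) (sym (*-identityʳ q)) 1<q)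
                      (^-monoʳ-≤ q {1} {n} (s≤s z≤n))

    B₁<q^n : B₁ N.< q ^ n
    B₁<q^n = concat-bound m (suc t) (two-digits-bound k<q 1<q) (digit-bound t k<q (full< t))

    -- Digit sums of the two blocks of u²; no carries since all entries are < q.
    s-B₁ : s k B₁ ≡ (k + 1) + (k + t * suc k)
    s-B₁ = trans (s-concat m _ _ (two-digits-bound k<q 1<q))
                 (cong₂ _+_ (s-digit 1 k<q)
                            (trans (s-digit (full t) k<q) (cong (_+_ k) (s-full t))))

    -- The entry 2 of B₂ is a genuine digit only when q ≥ 3.
    module _ (2<q : 2 N.< q) where
      s-B₂ : s k B₂ ≡ k + (2 + (k + c * suc k))
      s-B₂ = trans (s-concat m _ _ (two-digits-bound (s≤s z≤n) k<q))
                   (cong₂ _+_ (trans (s-digit k (s≤s z≤n)) (s-single k<q))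
                              (trans (s-digit (k + q * full c) 2<q)
                                     (cong (_+_ 2) (trans (s-digit (full c) k<q) (cong (_+_ k) (s-full c))))))

      s-u² : s k (u * u) ≡ (c + 4 + t) * suc k
      s-u² = begin
          s k (u * u)                              ≡⟨ cong (s k) square-expansion ⟩
          s k (1 + q ^ n * (B₁ + q ^ n * B₂))      ≡⟨ s-concat n 1 _ 1<q^n ⟩
          1 + s k (B₁ + q ^ n * B₂)                ≡⟨ cong (_+_ 1) (s-concat n B₁ B₂ B₁<q^n) ⟩
          1 + (s k B₁ + s k B₂)                    ≡⟨ cong (_+_ 1) (cong₂ _+_ s-B₁ s-B₂) ⟩
          1 + (((k + 1) + (k + t * suc k)) + (k + (2 + (k + c * suc k)))) ≡⟨ lemma k c t ⟩
          (c + 4 + t) * suc k                      ∎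
        where
        open ≡-Reasoning
        lemma : ∀ k c t → 1 + (((k + 1) + (k + t * suc k)) + (k + (2 + (k + c * suc k))))
                            ≡ (c + 4 + t) * suc k
        lemma = solve-∀

  ratio-N/N+c : 2 N.< q → ∀ c N → c + 4 ≤ N →
    ∃ λ u → s k (u * u) ≡ N * suc k × s k u ≡ (N + c) * suc k
  ratio-N/N+c 2<q c N c+4≤N with m≤n⇒∃[o]m+o≡n c+4≤N
  ... | t , refl = Witness.u c t , Witness.s-u² c t 2<q , Witness.s-u c t

cancel-factor : ∀ f a d → (+ (suc f * a)) / (suc f * suc d) ≡ (+ a) / suc d
cancel-factor f a d = fromℚᵘ-cong {mkℚᵘ (+ (suc f * a)) (d + f * suc d)} {mkℚᵘ (+ a) d} (*≡* cross)
  where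
  lemma : ∀ f a d → suc f * a * suc d ≡ a * (suc f * suc d)
  lemma = solve-∀
  cross : + (suc f * a) Z.* + suc d ≡ + a Z.* + (suc f * suc d)
  cross = trans (sym (pos-* (suc f * a) (suc d))) (trans (cong +_ (lemma f a d)) (pos-* a (suc f * suc d)))

split-fraction : ∀ {a b} → a ≤ b → b N.< a * 2 → ∃ λ e → a + e ≡ b × e N.< a
split-fraction {a} a≤b b<2a with m≤n⇒∃[o]m+o≡n a≤b
... | e , a+e≡b = e , a+e≡b , +-cancelˡ-< a e a a+e<a+a
  where
  a+e<a+a : a + e N.< a + a
  a+e<a+a = subst₂ N._<_ (sym a+e≡b) (trans (*-comm a 2) (cong (_+_ a) (+-identityʳ a))) b<2a

-- Scaling e < a by 4 gives the side condition c + 4 ≤ N of ratio-N/N+c.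
scale-by-four : ∀ {e a} → e N.< a → 4 * e + 4 ≤ 4 * a
scale-by-four {e} e<a = ≤-trans (≤-reflexive (lemma e)) (*-monoʳ-≤ 4 e<a)
  where
  lemma : ∀ e → 4 * e + 4 ≡ 4 * suc e
  lemma = solve-∀

-- The fraction a/b with a ≤ b < 2a is attained: a/b = 4a/(4a + 4e) with b = a + e.
attain-fraction : ∀ k → 2 N.< suc (suc k) → ∀ a d → a ≤ suc d → suc d N.< a * 2 →
  RatioAttained k ((+ a) / suc d)
attain-fraction k 2<q a d a≤b b<2a with split-fraction a≤b b<2a
... | e , a+e≡b , e<a with ratio-N/N+c k 2<q (4 * e) (4 * a) (scale-by-four e<a)
... | u , s-u² , s-u = u , nonzero , trans (/-cong {{nonzero}} (cong +_ numerator) denominator)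
                                         (cancel-factor (3 + 4 * k) a d)
  where
  open ≡-Reasoning
  numerator : s k (u * u) ≡ suc (3 + 4 * k) * a
  numerator = trans s-u² (lemma k a)
    where
    lemma : ∀ k a → 4 * a * suc k ≡ suc (3 + 4 * k) * a
    lemma = solve-∀
  denominator : s k u ≡ suc (3 + 4 * k) * suc d
  denominator = begin
    s k u                      ≡⟨ s-u ⟩
    (4 * a + 4 * e) * suc k    ≡⟨ lemma k a e ⟩
    suc (3 + 4 * k) * (a + e)  ≡⟨ cong (suc (3 + 4 * k) *_) a+e≡b ⟩
    suc (3 + 4 * k) * suc d    ∎
    where
    lemma : ∀ k a e → (4 * a + 4 * e) * suc k ≡ suc (3 + 4 * k) * (a + e)
    lemma = solve-∀
  nonzero : NonZero (s k u)
  nonzero = subst NonZero (sym denominator) _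

½<-numerator : ∀ {a d} .{cop : Coprime a (suc d)} → ½ < mkℚ (+ a) d cop → suc d N.< a * 2
½<-numerator {a} {d} (*<* p) =
  subst (N._< a * 2) (*-identityˡ (suc d)) (drop‿+<+ (subst₂ Z._<_ (sym (pos-* 1 (suc d))) (sym (pos-* a 2)) p))

<1-numerator : ∀ {a d} .{cop : Coprime a (suc d)} → mkℚ (+ a) d cop < 1ℚ → a ≤ suc d
<1-numerator {a} {d} (*<* p) =
  <⇒≤ (subst₂ N._<_ (*-identityʳ a) (*-identityˡ (suc d))
        (drop‿+<+ (subst₂ Z._<_ (sym (pos-* a 1)) (sym (pos-* 1 (suc d))) p)))

lemma3p5 : (k : ℕ) → 3 ≤ k → (r : ℚ) → ½ < r → r < 1ℚ →
    ∃ λ u → Σ (NonZero (s k u)) λ nz →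
      ((+ s k (u * u)) / s k u) {{nz}} ≡ r
lemma3p5 k 3≤k (mkℚ -[1+ _ ] _ _) (*<* ()) _
lemma3p5 k 3≤k r@(mkℚ (+ a) d _) ½<r r<1 =
  subst (RatioAttained k) (↥p/↧p≡p r)
        (attain-fraction k 2<q a d (<1-numerator r<1) (½<-numerator ½<r))
  where
  2<q : 2 N.< suc (suc k)
  2<q = s≤s (s≤s (≤-trans (s≤s z≤n) 3≤k))
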